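{- For every $n\in\mathbb{N}_0$ and every infinite binary vector $\mathbf{b}\in\{0,1\}^{\mathbb{N}}$ it holds that $H_{GP}(n,\mathbf{b})\le H_{WU}(n,\mathbf{b})$.
   Context: For an infinite sequence $s=(s_1,s_2,\ldots)$, $\mathrm{ODD}(s)=(s_1,s_3,\ldots)$ and $\mathrm{EVEN}(s)=(s_2,s_4,\ldots)$. For a binary vector $\mathbf{c}$ and a bit $a$, $a\mathbf{c}$ denotes the vector with first entry $a$ followed by $\mathbf{c}$. The function $H_{GP}:\mathbb{N}_0\times\{0,1\}^{\mathbb{N}}\to\mathbb{N}_0$ (the time complexity of the Gasieniec–Pelc rumor spreading algorithm with $k$ processors still to be informed and failure pattern $\mathbf{b}$, where $0$ means a failed request and $1$ a successful one) is defined recursively by $H_{GP}(0,\mathbf{b})=0$ and, for $k>0$, $H_{GP}(k,0\mathbf{c})=1+H_{GP}(k-1,\mathbf{c})$ and $H_{GP}(k,1\mathbf{c})=1+\max\{H_{GP}(\lceil\tfrac{k-1}{2}\rceil,\mathrm{ODD}(\mathbf{c})),\,H_{GP}(\lfloor\tfrac{k-1}{2}\rfloor,\mathrm{EVEN}(\mathbf{c}))\}$. The function $H_{WU}:\mathbb{N}_0\times\{0,1\}^{\mathbb{N}}\to\mathbb{N}_0\cup\{\infty\}$ (the time complexity of the random wakeup variant, in which a failed request is repeated) is defined by $H_{WU}(0,\mathbf{b})=0$; for $k>0$, $H_{WU}(k,\mathbf{0})=\infty$ for the all-zeros vector $\mathbf{0}$, and if $\mathbf{b}=0^m1\mathbf{c}$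 (i.e. $m\ge 0$ zeros followed by a one) then $H_{WU}(k,\mathbf{b})=m+1+\max\{H_{WU}(\lceil\tfrac{k-1}{2}\rceil,\mathrm{ODD}(\mathbf{c})),\,H_{WU}(\lfloor\tfrac{k-1}{2}\rfloor,\mathrm{EVEN}(\mathbf{c}))\}$. -}

module Defs where

open import Data.Bool using (Bool; true; false)
open import Data.Nat using (ℕ; zero; suc; _+_; _*_; _<_; _⊔_; ⌊_/2⌋; ⌈_/2⌉)
open import Relation.Binary.PropositionalEquality using (_≡_)

-- Infinite binary vectors b = (b_1, b_2, ...) as functions ℕ → Bool,
-- 0-indexed: b 0 = b_1.  true = 1 (successful request), false = 0 (failed).
BinSeq : Set
BinSeq = ℕ → Bool

-- ODD(s) = (s_1, s_3, ...) ; EVEN(s) = (s_2, s_4, ...)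
ODD : BinSeq → BinSeq
ODD s i = s (2 * i)

EVEN : BinSeq → BinSeq
EVEN s i = s (suc (2 * i))

drop : ℕ → BinSeq → BinSeq
drop n s i = s (n + i)

tail : BinSeq → BinSeq
tail = drop 1

-- H_GP, computed with a fuel argument (fuel k suffices for H_GP k b,
-- since all recursive calls on k > 0 use arguments ≤ k - 1).
hgp : ℕ → ℕ → BinSeq → ℕ
hgp _        zero    b = 0
hgp zero     (suc k) b = 0   -- unreachable when fuel ≥ k
hgp (suc f) (suc k) b with b 0
... | false = suc (hgp f k (tail b))
... | true  = suc (hgp f ⌈ k /2⌉ (ODD (tail b)) ⊔ hgp f ⌊ k /2⌋ (EVEN (tail b)))

H-GP : ℕ → BinSeq → ℕ
H-GP k b = hgp k k b

-- H_WU as its graph: H-WU k b v  means  H_WU(k, b) = v  (a finite value).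
-- H_WU(k, b) = ∞ exactly when there is no finite v with H-WU k b v.
-- Clause for k > 0:  b = 0^m 1 c  with  c = drop (m+1) b.
data H-WU : ℕ → BinSeq → ℕ → Set where
  wu-zero : ∀ b → H-WU zero b zero
  wu-step : ∀ k b m v₁ v₂ →
            (∀ i → i < m → b i ≡ false) →
            b m ≡ true →
            H-WU ⌈ k /2⌉ (ODD (drop (suc m) b)) v₁ →
            H-WU ⌊ k /2⌋ (EVEN (drop (suc m) b)) v₂ →
            H-WU (suc k) b (m + 1 + (v₁ ⊔ v₂))

module Submission where

-- A failed request costs the Gasieniec–Pelc algorithm one
-- round but also removes one processor from the set still to be informed,
-- whereas the wakeup variant spends the round without progress.  Hence GP
-- is never slower, provided the comparison is made against every smaller
-- number of processors as well: we prove, by induction on the derivation of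
-- H_WU(k, b) = v, the stronger invariant
--     GP-bounded k b v :  H_GP(j, b) ≤ v  for all  j ≤ k  (and all fuel).

open import Defs
open import Data.Nat using (ℕ; zero; suc; _+_; _≤_; _<_; _⊔_; ⌊_/2⌋; ⌈_/2⌉; z≤n; s≤s)
open import Data.Nat.Properties using (≤-refl; <⇒≤; ⊔-mono-≤; ⌊n/2⌋-mono; ⌈n/2⌉-mono)
open import Data.Bool using (true; false)
open import Relation.Binary.PropositionalEquality using (_≡_)

-- v bounds the GP time on b for every number of processors j ≤ k and every
-- amount of fuel; quantifying over j is what lets a failure (which lowers
-- the GP argument but not the WU argument) be absorbed.
GP-bounded : ℕ → BinSeq → ℕ → Set
GP-bounded k b v = ∀ f j → j ≤ k → hgp f j b ≤ v

-- A failed first request: GP spends one round and continues on the tail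
-- with one processor fewer, which the bound for j ≤ k already covers.
gp-failure : ∀ {k b v} → b 0 ≡ false →
             GP-bounded k (tail b) v → GP-bounded k b (suc v)
gp-failure b₀ bound zero    zero    _   = z≤n
gp-failure b₀ bound zero    (suc j) _   = z≤n
gp-failure b₀ bound (suc f) zero    _   = z≤n
gp-failure b₀ bound (suc f) (suc j) j<k rewrite b₀ =
  s≤s (bound f j (<⇒≤ j<k))

-- A successful first request: GP splits the remaining j processors into
-- halves served by the odd and even subsequences of the tail, and halving
-- is monotone, so the bounds for ⌈k/2⌉ and ⌊k/2⌋ apply.
gp-success : ∀ {k b v₁ v₂} → b 0 ≡ true →
             GP-bounded ⌈ k /2⌉ (ODD (tail b)) v₁ →
             GP-bounded ⌊ k /2⌋ (EVEN (tail b)) v₂ →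
             GP-bounded (suc k) b (suc (v₁ ⊔ v₂))
gp-success b₀ bound₁ bound₂ zero    zero    _         = z≤n
gp-success b₀ bound₁ bound₂ zero    (suc j) _         = z≤n
gp-success b₀ bound₁ bound₂ (suc f) zero    _         = z≤n
gp-success b₀ bound₁ bound₂ (suc f) (suc j) (s≤s j≤k) rewrite b₀ =
  s≤s (⊔-mono-≤ (bound₁ f ⌈ j /2⌉ (⌈n/2⌉-mono j≤k))
                (bound₂ f ⌊ j /2⌋ (⌊n/2⌋-mono j≤k)))

gp-phase : ∀ {k b v₁ v₂} (m : ℕ) →
           (∀ i → i < m → b i ≡ false) → b m ≡ true →
           GP-bounded ⌈ k /2⌉ (ODD (drop (suc m) b)) v₁ →
           GP-bounded ⌊ k /2⌋ (EVEN (drop (suc m) b)) v₂ →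
           GP-bounded (suc k) b (m + 1 + (v₁ ⊔ v₂))
gp-phase zero    zeros bₘ bound₁ bound₂ = gp-success bₘ bound₁ bound₂
gp-phase (suc m) zeros bₘ bound₁ bound₂ =
  gp-failure (zeros 0 (s≤s z≤n))
             (gp-phase m (λ i i<m → zeros (suc i) (s≤s i<m)) bₘ bound₁ bound₂)

wu⇒gp-bounded : ∀ {k b v} → H-WU k b v → GP-bounded k b v
wu⇒gp-bounded (wu-zero b) f zero z≤n = z≤n
wu⇒gp-bounded (wu-step k b m v₁ v₂ zeros bₘ wu₁ wu₂) =
  gp-phase m zeros bₘ (wu⇒gp-bounded wu₁) (wu⇒gp-bounded wu₂)

lemma7 : (n : ℕ) (b : BinSeq) (v : ℕ) → H-WU n b v → H-GP n b ≤ v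
lemma7 n b v wu = wu⇒gp-bounded wu n n ≤-refl
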